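{- Let $\xi_0,\dots,\xi_s\in\mathbb{R}$ with $\xi_0\neq0$, and let $L_n=l_{0,n}X_0+\dots+l_{s,n}X_s\in\mathbb{Z}[X_0,\dots,X_s]$ ($n\in\mathbb{N}$) be a sequence of non-trivial linear forms with integer coefficients. Assume there is an unbounded subset $I\subseteq\mathbb{N}$ and for each $n\in I$ a prime $l(n)$ such that: (i) $|L_n(\xi_0,\dots,\xi_s)|\to0$ as $n\to\infty$; (ii) for all $n\in I$, $v_{l(n)}(l_{0,n})<v_{l(n)}(l_{i,n})$ for $i=1,\dots,s$; (iii) $l(n)\to\infty$ as $n\to\infty$. Then at least one of $\xi_0,\dots,\xi_s$ is irrational.
   Context: $v_\ell$ denotes the $\ell$-adic valuation on $\mathbb{Q}$ (with $v_\ell(0)=\infty$). -}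

module Defs where

open import Data.Nat as ℕ using (ℕ; zero; suc; _≤_)
open import Data.Nat.DivMod using (_/_)
open import Data.Nat.Divisibility using (_∣?_)
open import Data.Integer as ℤ using (ℤ; ∣_∣)
open import Data.Integer.Properties as ℤP using ()
open import Data.Fin using (Fin)
open import Data.List using (List; foldr; map)
open import Data.List.Base using (allFin)
open import Data.Rational as ℚ using (ℚ; 0ℚ)
open import Relation.Nullary using (yes; no)

data ℕ∞ : Set where
  fin : ℕ → ℕ∞
  ∞   : ℕ∞

data _<∞_ : ℕ∞ → ℕ∞ → Set where
  fin<fin : ∀ {m n} → m ℕ.< n → fin m <∞ fin n
  fin<∞   : ∀ {m} → fin m <∞ ∞

-- number of times p divides n, computed with fuel
-- (with fuel ≥ n, n ≠ 0 and p ≥ 2 this is exactly the p-adic valuation of n)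
valAux : ℕ → ℕ → ℕ → ℕ
valAux zero    p       n = 0
valAux (suc f) zero    n = 0
valAux (suc f) (suc q) n with suc q ∣? n
... | yes _ = suc (valAux f (suc q) (n / suc q))
... | no  _ = 0

-- ℓ-adic valuation of an integer (v_ℓ(0) = ∞); meaningful for ℓ prime
v : ℕ → ℤ → ℕ∞
v ℓ a with ∣ a ∣
... | zero  = ∞
... | suc m = fin (valAux (suc m) ℓ (suc m))

ℤ→ℚ : ℤ → ℚ
ℤ→ℚ a = a ℚ./ 1

evalForm : ∀ {k} → (Fin k → ℤ) → (Fin k → ℚ) → ℚ
evalForm {k} c ξ = foldr ℚ._+_ 0ℚ (map (λ i → ℤ→ℚ (c i) ℚ.* ξ i) (allFin k))

-- Suppose all ξᵢ are rational and let D be the denominator of the unnormalised sum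
-- L(ξ) = Σ lᵢ ξᵢ; it depends only on ξ, so |L_n(ξ)| < 1/D forces the numerator of
-- L_n(ξ) to vanish. With p = l(n) and e = v_p(l₀), every other lᵢ is divisible by
-- p^(e+1), so the vanishing numerator gives p^(e+1) ∣ l₀ · ↥ξ₀ · D′, where D′ is the
-- denominator of the tail; hence p ∣ ↥ξ₀ · D′, a nonzero number fixed in advance,
-- which is impossible once p exceeds it.

module Submission where

open import Defs
open import Data.Nat as ℕ using (ℕ; zero; suc; _≤_; _^_; z≤n; s≤s)
import Data.Nat.Properties as ℕ
open import Data.Nat.Divisibility as ℕ using (_∣_; _∤_; _∣?_)
open import Data.Nat.DivMod using (_/_; m/n*n≡m; m/n<m)
open import Data.Nat.Primality using (Prime; euclidsLemma; prime⇒nonTrivial)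
open import Data.Integer as ℤ using (ℤ; +_; ∣_∣)
import Data.Integer.Properties as ℤ
import Data.Integer.Divisibility.Signed as ℤ
open import Data.Fin as Fin using (Fin)
open import Data.List using (foldr)
open import Data.List.Properties using (map-tabulate)
open import Data.Rational as ℚ using (ℚ; 0ℚ; ↥_; ↧_)
import Data.Rational.Properties as ℚ
open import Data.Rational.Unnormalised as ℚᵘ using (ℚᵘ; mkℚᵘ; *<*)
import Data.Rational.Unnormalised.Properties as ℚᵘ
open import Data.Product using (∃; _×_; _,_)
open import Data.Sum using ([_,_])
open import Data.Empty using (⊥)
open import Function using (_∘_; id)
open import Relation.Nullary using (yes; no; contradiction)
open import Relation.Binary.PropositionalEquality using (_≡_; _≢_; refl; sym; trans; cong; cong₂; subst; subst₂; module ≡-Reasoning)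

pow-∣-pow : ∀ p {m n} → m ≤ n → p ^ m ∣ p ^ n
pow-∣-pow p {m} {n} m≤n = subst (λ k → p ^ m ∣ p ^ k) (ℕ.m+[n∸m]≡n m≤n)
  (subst (p ^ m ∣_) (sym (ℕ.^-distribˡ-+-* p m (n ℕ.∸ m))) (ℕ.m∣m*n _))

pow-valAux-∣ : ∀ f p n → p ^ valAux f p n ∣ n
pow-valAux-∣ zero    p       n = ℕ.1∣ n
pow-valAux-∣ (suc f) zero    n = ℕ.1∣ n
pow-valAux-∣ (suc f) (suc q) n with suc q ∣? n
... | no  _   = ℕ.1∣ n
... | yes q∣n = subst (suc q ^ suc (valAux f (suc q) (n / suc q)) ∣_)
  (trans (ℕ.*-comm (suc q) (n / suc q)) (m/n*n≡m q∣n))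
  (ℕ.*-monoʳ-∣ (suc q) (pow-valAux-∣ f (suc q) (n / suc q)))

-- The fuel f ≥ n suffices because n / p < n at every recursive call.
pow-suc-valAux-∤ : ∀ f p n → 2 ≤ p → 1 ≤ n → n ≤ f → p ^ suc (valAux f p n) ∤ n
pow-suc-valAux-∤ zero    p       zero    _ () _
pow-suc-valAux-∤ (suc f) (suc q) n p≥2 n≥1 n≤f+1 p^k+1∣n with suc q ∣? n
... | no  q∤n = q∤n (subst (_∣ n) (ℕ.*-identityʳ (suc q)) p^k+1∣n)
... | yes q∣n = pow-suc-valAux-∤ f (suc q) (n / suc q) p≥2 n/q≥1 n/q≤f
      (ℕ.*-cancelʳ-∣ (suc q) (subst₂ _∣_ (ℕ.*-comm (suc q) _) (sym n/q*q≡n) p^k+1∣n))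
  where
  instance _ = ℕ.>-nonZero n≥1
  n/q*q≡n : n / suc q ℕ.* suc q ≡ n
  n/q*q≡n = m/n*n≡m q∣n
  n/q≥1 : 1 ≤ n / suc q
  n/q≥1 = ℕ.n≢0⇒n>0 λ n/q≡0 → ℕ.<⇒≢ n≥1 (trans (cong (ℕ._* suc q) (sym n/q≡0)) n/q*q≡n)
  n/q≤f : n / suc q ≤ f
  n/q≤f = ℕ.≤-pred (ℕ.≤-trans (m/n<m n (suc q) p≥2) n≤f+1)

v-exact : ∀ p {a} → 2 ≤ p → a ≢ + 0 →
          ∃ λ e → v p a ≡ fin e × p ^ e ∣ ∣ a ∣ × p ^ suc e ∤ ∣ a ∣
v-exact p {a} p≥2 a≢0 with ∣ a ∣ in ∣a∣≡
... | zero  = contradiction (ℤ.∣i∣≡0⇒i≡0 ∣a∣≡) a≢0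
... | suc m = valAux (suc m) p (suc m) , refl , pow-valAux-∣ (suc m) p (suc m)
            , pow-suc-valAux-∤ (suc m) p (suc m) p≥2 (s≤s z≤n) ℕ.≤-refl

v>⇒pow-suc-∣ : ∀ p e b → fin e <∞ v p b → p ^ suc e ∣ ∣ b ∣
v>⇒pow-suc-∣ p e b e<vb with ∣ b ∣
... | zero  = ℕ._∣0 _
... | suc m with e<vb
... | fin<fin e<k = ℕ.∣-trans (pow-∣-pow p e<k) (pow-valAux-∣ (suc m) p (suc m))

v<∞⇒≢0 : ∀ p a {x} → v p a <∞ x → a ≢ + 0
v<∞⇒≢0 p a () refl

pow-exact-∣*⇒∣ : ∀ {p} e {a} b → Prime p → p ^ e ∣ a → p ^ suc e ∤ a → p ^ suc e ∣ a ℕ.* b → p ∣ b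
pow-exact-∣*⇒∣ {p} e b p-prime (ℕ.divides-refl q) p^e+1∤a p^e+1∣ab =
  [ (λ p∣q → contradiction (ℕ.*-monoˡ-∣ (p ^ e) p∣q) p^e+1∤a) , id ] (euclidsLemma q b p-prime p∣qb)
  where
  instance
    _ = ℕ.nonTrivial⇒nonZero p {{prime⇒nonTrivial p-prime}}
    _ = ℕ.m^n≢0 p e
  rearrange : q ℕ.* p ^ e ℕ.* b ≡ p ^ e ℕ.* (q ℕ.* b)
  rearrange = trans (cong (ℕ._* b) (ℕ.*-comm q (p ^ e))) (ℕ.*-assoc (p ^ e) q b)
  p∣qb : p ∣ q ℕ.* b
  p∣qb = ℕ.*-cancelˡ-∣ (p ^ e) (subst₂ _∣_ (ℕ.*-comm p (p ^ e)) rearrange p^e+1∣ab)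

v-gap⇒leading≢0 : ∀ s p (c : Fin (suc s) → ℤ) → (∃ λ i → c i ≢ + 0) →
                  (∀ i → v p (c Fin.zero) <∞ v p (c (Fin.suc i))) → c Fin.zero ≢ + 0
v-gap⇒leading≢0 zero    p c (Fin.zero , c₀≢0) _   = c₀≢0
v-gap⇒leading≢0 (suc s) p c _                 gap = v<∞⇒≢0 p (c Fin.zero) (gap Fin.zero)

-- Evaluating without normalising keeps the denominator independent of the
-- coefficients and the numerator ℤ-linear in them.
evalFormᵘ : ∀ {k} → (Fin k → ℤ) → (Fin k → ℚ) → ℚᵘ
evalFormᵘ {zero}  c ξ = ℚᵘ.0ℚᵘ
evalFormᵘ {suc k} c ξ = mkℚᵘ (c Fin.zero) 0 ℚᵘ.* ℚ.toℚᵘ (ξ Fin.zero)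
                        ℚᵘ.+ evalFormᵘ (c ∘ Fin.suc) (ξ ∘ Fin.suc)

formDenominator-1 : ∀ {k} → (Fin k → ℚ) → ℕ
formDenominator-1 ξ = ℚᵘ.denominator-1 (evalFormᵘ (λ _ → + 0) ξ)

↥ᵘ-+ : ∀ p q → ℚᵘ.↥ (p ℚᵘ.+ q) ≡ ℚᵘ.↥ p ℤ.* ℚᵘ.↧ q ℤ.+ ℚᵘ.↥ q ℤ.* ℚᵘ.↧ p
↥ᵘ-+ (mkℚᵘ _ _) (mkℚᵘ _ _) = refl

↥ᵘ-* : ∀ p q → ℚᵘ.↥ (p ℚᵘ.* q) ≡ ℚᵘ.↥ p ℤ.* ℚᵘ.↥ q
↥ᵘ-* (mkℚᵘ _ _) (mkℚᵘ _ _) = refl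

↧ₙᵘ-+ : ∀ p q → ℚᵘ.↧ₙ (p ℚᵘ.+ q) ≡ ℚᵘ.↧ₙ p ℕ.* ℚᵘ.↧ₙ q
↧ₙᵘ-+ (mkℚᵘ _ _) (mkℚᵘ _ _) = refl

↧ₙᵘ-* : ∀ p q → ℚᵘ.↧ₙ (p ℚᵘ.* q) ≡ ℚᵘ.↧ₙ p ℕ.* ℚᵘ.↧ₙ q
↧ₙᵘ-* (mkℚᵘ _ _) (mkℚᵘ _ _) = refl

↧ₙ-evalFormᵘ : ∀ {k} (c c′ : Fin k → ℤ) ξ → ℚᵘ.↧ₙ (evalFormᵘ c ξ) ≡ ℚᵘ.↧ₙ (evalFormᵘ c′ ξ)
↧ₙ-evalFormᵘ {zero}  c c′ ξ = refl
↧ₙ-evalFormᵘ {suc k} c c′ ξ = begin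
  ℚᵘ.↧ₙ (head c ℚᵘ.+ evalFormᵘ (c ∘ Fin.suc) (ξ ∘ Fin.suc))     ≡⟨ ↧ₙᵘ-+ (head c) _ ⟩
  ℚᵘ.↧ₙ (head c) ℕ.* ℚᵘ.↧ₙ (evalFormᵘ (c ∘ Fin.suc) (ξ ∘ Fin.suc))
    ≡⟨ cong₂ ℕ._*_ ↧ₙ-head (↧ₙ-evalFormᵘ (c ∘ Fin.suc) (c′ ∘ Fin.suc) (ξ ∘ Fin.suc)) ⟩
  ℚᵘ.↧ₙ (head c′) ℕ.* ℚᵘ.↧ₙ (evalFormᵘ (c′ ∘ Fin.suc) (ξ ∘ Fin.suc)) ≡⟨ sym (↧ₙᵘ-+ (head c′) _) ⟩
  ℚᵘ.↧ₙ (head c′ ℚᵘ.+ evalFormᵘ (c′ ∘ Fin.suc) (ξ ∘ Fin.suc))   ∎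
  where
  open ≡-Reasoning
  q₀ = ℚ.toℚᵘ (ξ Fin.zero)
  head : (Fin (suc k) → ℤ) → ℚᵘ
  head c = mkℚᵘ (c Fin.zero) 0 ℚᵘ.* q₀
  ↧ₙ-head : ℚᵘ.↧ₙ (head c) ≡ ℚᵘ.↧ₙ (head c′)
  ↧ₙ-head = trans (↧ₙᵘ-* (mkℚᵘ (c Fin.zero) 0) q₀) (sym (↧ₙᵘ-* (mkℚᵘ (c′ Fin.zero) 0) q₀))

denominator-1-evalFormᵘ : ∀ {k} (c : Fin k → ℤ) ξ → ℚᵘ.denominator-1 (evalFormᵘ c ξ) ≡ formDenominator-1 ξ
denominator-1-evalFormᵘ c ξ = ℕ.suc-injective (↧ₙ-evalFormᵘ c (λ _ → + 0) ξ)

↥-evalFormᵘ-suc : ∀ {k} (c : Fin (suc k) → ℤ) ξ → ℚᵘ.↥ (evalFormᵘ c ξ) ≡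
  c Fin.zero ℤ.* (↥ ξ Fin.zero ℤ.* + suc (formDenominator-1 (ξ ∘ Fin.suc)))
  ℤ.+ ℚᵘ.↥ (evalFormᵘ (c ∘ Fin.suc) (ξ ∘ Fin.suc)) ℤ.* ↧ ξ Fin.zero
↥-evalFormᵘ-suc c ξ = begin
  ℚᵘ.↥ (h ℚᵘ.+ t)                                 ≡⟨ ↥ᵘ-+ h t ⟩
  ℚᵘ.↥ h ℤ.* ℚᵘ.↧ t ℤ.+ ℚᵘ.↥ t ℤ.* ℚᵘ.↧ h          ≡⟨ cong₂ (λ x y → x ℤ.* y ℤ.+ ℚᵘ.↥ t ℤ.* ℚᵘ.↧ h) ↥h ↧t ⟩
  c₀ ℤ.* ↥ ξ Fin.zero ℤ.* + D ℤ.+ ℚᵘ.↥ t ℤ.* ℚᵘ.↧ h ≡⟨ cong₂ ℤ._+_ (ℤ.*-assoc c₀ _ _) (cong (ℚᵘ.↥ t ℤ.*_) ↧h) ⟩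
  c₀ ℤ.* (↥ ξ Fin.zero ℤ.* + D) ℤ.+ ℚᵘ.↥ t ℤ.* ↧ ξ Fin.zero ∎
  where
  open ≡-Reasoning
  c₀ = c Fin.zero
  q₀ = ℚ.toℚᵘ (ξ Fin.zero)
  h = mkℚᵘ c₀ 0 ℚᵘ.* q₀
  t = evalFormᵘ (c ∘ Fin.suc) (ξ ∘ Fin.suc)
  D = suc (formDenominator-1 (ξ ∘ Fin.suc))
  ↥h : ℚᵘ.↥ h ≡ c₀ ℤ.* ↥ ξ Fin.zero
  ↥h = trans (↥ᵘ-* (mkℚᵘ c₀ 0) q₀) (cong (c₀ ℤ.*_) (ℚ.↥ᵘ-toℚᵘ (ξ Fin.zero)))
  ↧t : ℚᵘ.↧ t ≡ + D
  ↧t = cong (+_ ∘ suc) (denominator-1-evalFormᵘ (c ∘ Fin.suc) (ξ ∘ Fin.suc))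
  ↧h : ℚᵘ.↧ h ≡ ↧ ξ Fin.zero
  ↧h = trans (cong +_ (trans (↧ₙᵘ-* (mkℚᵘ c₀ 0) q₀) (ℕ.*-identityˡ _))) (ℚ.↧ᵘ-toℚᵘ (ξ Fin.zero))

∣-↥-evalFormᵘ : ∀ {k} m (c : Fin k → ℤ) ξ → (∀ i → m ℤ.∣ c i) → m ℤ.∣ ℚᵘ.↥ (evalFormᵘ c ξ)
∣-↥-evalFormᵘ {zero}  m c ξ m∣c = ℤ.∣ᵤ⇒∣ (ℕ._∣0 _)
∣-↥-evalFormᵘ {suc k} m c ξ m∣c = subst (m ℤ.∣_) (sym (↥-evalFormᵘ-suc c ξ)) (ℤ.∣m∣n⇒∣m+n
  (ℤ.∣m⇒∣m*n _ (m∣c Fin.zero))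
  (ℤ.∣m⇒∣m*n _ (∣-↥-evalFormᵘ m (c ∘ Fin.suc) (ξ ∘ Fin.suc) (m∣c ∘ Fin.suc))))

evalForm-suc : ∀ {k} (c : Fin (suc k) → ℤ) ξ → evalForm c ξ ≡
  ℤ→ℚ (c Fin.zero) ℚ.* ξ Fin.zero ℚ.+ evalForm (c ∘ Fin.suc) (ξ ∘ Fin.suc)
evalForm-suc {k} c ξ = cong (λ xs → term Fin.zero ℚ.+ foldr ℚ._+_ 0ℚ xs)
  (trans (map-tabulate Fin.suc term) (sym (map-tabulate id (term ∘ Fin.suc))))
  where
  term : Fin (suc k) → ℚ
  term i = ℤ→ℚ (c i) ℚ.* ξ i

toℚᵘ-evalForm : ∀ {k} (c : Fin k → ℤ) ξ → ℚ.toℚᵘ (evalForm c ξ) ℚᵘ.≃ evalFormᵘ c ξ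
toℚᵘ-evalForm {zero}  c ξ = ℚᵘ.≃-refl
toℚᵘ-evalForm {suc k} c ξ = begin
  ℚ.toℚᵘ (evalForm c ξ)                                        ≡⟨ cong ℚ.toℚᵘ (evalForm-suc c ξ) ⟩
  ℚ.toℚᵘ (ℤ→ℚ c₀ ℚ.* ξ Fin.zero ℚ.+ evalForm (c ∘ Fin.suc) (ξ ∘ Fin.suc))
    ≈⟨ ℚ.toℚᵘ-homo-+ (ℤ→ℚ c₀ ℚ.* ξ Fin.zero) _ ⟩
  ℚ.toℚᵘ (ℤ→ℚ c₀ ℚ.* ξ Fin.zero) ℚᵘ.+ ℚ.toℚᵘ (evalForm (c ∘ Fin.suc) (ξ ∘ Fin.suc))
    ≈⟨ ℚᵘ.+-cong (ℚ.toℚᵘ-homo-* (ℤ→ℚ c₀) (ξ Fin.zero)) (toℚᵘ-evalForm (c ∘ Fin.suc) (ξ ∘ Fin.suc)) ⟩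
  ℚ.toℚᵘ (ℤ→ℚ c₀) ℚᵘ.* ℚ.toℚᵘ (ξ Fin.zero) ℚᵘ.+ evalFormᵘ (c ∘ Fin.suc) (ξ ∘ Fin.suc)
    ≈⟨ ℚᵘ.+-congˡ (evalFormᵘ (c ∘ Fin.suc) (ξ ∘ Fin.suc)) (ℚᵘ.*-congʳ (ℚ.toℚᵘ-fromℚᵘ (mkℚᵘ c₀ 0))) ⟩
  evalFormᵘ c ξ                                                ∎
  where
  open ℚᵘ.≃-Reasoning
  c₀ = c Fin.zero

∣toℚᵘ∣<1/↧⇒↥≡0 : ∀ q X → ℚ.toℚᵘ q ℚᵘ.≃ X → ℚ.∣ q ∣ ℚ.< + 1 ℚ./ suc (ℚᵘ.denominator-1 X) → ℚᵘ.↥ X ≡ + 0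
∣toℚᵘ∣<1/↧⇒↥≡0 q X@(mkℚᵘ z d) q≃X ∣q∣<1/d =
  ℤ.∣i∣≡0⇒i≡0 (ℕ.n<1⇒n≡0 (ℤ.drop‿+<+ ∣z∣<1))
  where
  ∣X∣<1/d : ℚᵘ.∣ X ∣ ℚᵘ.< mkℚᵘ (+ 1) d
  ∣X∣<1/d = ℚᵘ.<-respˡ-≃ (ℚᵘ.≃-trans (ℚ.toℚᵘ-homo-∣-∣ q) (ℚᵘ.∣-∣-cong q≃X))
              (ℚᵘ.<-respʳ-≃ (ℚ.toℚᵘ-fromℚᵘ (mkℚᵘ (+ 1) d)) (ℚ.toℚᵘ-mono-< ∣q∣<1/d))
  ∣z∣<1 : + ∣ z ∣ ℤ.< + 1
  ∣z∣<1 with ∣X∣<1/d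
  ... | *<* ∣z∣*d<1*d = ℤ.*-cancelʳ-<-nonNeg (+ suc d) ∣z∣*d<1*d

evalForm-small⇒↥evalFormᵘ≡0 : ∀ {k} (c : Fin k → ℤ) ξ →
  ℚ.∣ evalForm c ξ ∣ ℚ.< + 1 ℚ./ suc (formDenominator-1 ξ) → ℚᵘ.↥ (evalFormᵘ c ξ) ≡ + 0
evalForm-small⇒↥evalFormᵘ≡0 c ξ small = ∣toℚᵘ∣<1/↧⇒↥≡0 (evalForm c ξ) (evalFormᵘ c ξ) (toℚᵘ-evalForm c ξ)
  (subst (λ d → ℚ.∣ evalForm c ξ ∣ ℚ.< + 1 ℚ./ suc d) (sym (denominator-1-evalFormᵘ c ξ)) small)

v-gap⇒↥evalFormᵘ≢0 : ∀ {s} p (c : Fin (suc s) → ℤ) ξ → Prime p → c Fin.zero ≢ + 0 →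
  (∀ i → v p (c Fin.zero) <∞ v p (c (Fin.suc i))) →
  p ∤ ∣ ↥ ξ Fin.zero ∣ ℕ.* suc (formDenominator-1 (ξ ∘ Fin.suc)) →
  ℚᵘ.↥ (evalFormᵘ c ξ) ≢ + 0
v-gap⇒↥evalFormᵘ≢0 p c ξ p-prime c₀≢0 gap p∤ ↥≡0
  with v-exact p (ℕ.nonTrivial⇒n>1 p {{prime⇒nonTrivial p-prime}}) c₀≢0
... | e , v≡e , p^e∣c₀ , p^e+1∤c₀ = p∤ (pow-exact-∣*⇒∣ e _ p-prime p^e∣c₀ p^e+1∤c₀ p^e+1∣head)
  where
  c₀ = c Fin.zero
  D = suc (formDenominator-1 (ξ ∘ Fin.suc))
  m = + (p ^ suc e)
  head = c₀ ℤ.* (↥ ξ Fin.zero ℤ.* + D)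
  tail = ℚᵘ.↥ (evalFormᵘ (c ∘ Fin.suc) (ξ ∘ Fin.suc)) ℤ.* ↧ ξ Fin.zero
  m∣tail : m ℤ.∣ tail
  m∣tail = ℤ.∣m⇒∣m*n _ (∣-↥-evalFormᵘ m (c ∘ Fin.suc) (ξ ∘ Fin.suc) λ i →
             ℤ.∣ᵤ⇒∣ (v>⇒pow-suc-∣ p e (c (Fin.suc i)) (subst (_<∞ v p (c (Fin.suc i))) v≡e (gap i))))
  m∣head+tail : m ℤ.∣ head ℤ.+ tail
  m∣head+tail = subst (m ℤ.∣_) (trans (sym ↥≡0) (↥-evalFormᵘ-suc c ξ)) (ℤ.∣ᵤ⇒∣ (ℕ._∣0 _))
  p^e+1∣head : p ^ suc e ∣ ∣ c₀ ∣ ℕ.* (∣ ↥ ξ Fin.zero ∣ ℕ.* D)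
  p^e+1∣head = subst (p ^ suc e ∣_) (trans (ℤ.abs-* c₀ _) (cong (∣ c₀ ∣ ℕ.*_) (ℤ.abs-* (↥ ξ Fin.zero) (+ D))))
                 (ℤ.∣⇒∣ᵤ (ℤ.∣m+n∣n⇒∣m {m = head} m∣head+tail m∣tail))

lemma2p3 : (s : ℕ) (ξ : Fin (suc s) → ℚ) → ξ Fin.zero ≢ 0ℚ
    → (l : ℕ → Fin (suc s) → ℤ)
    → (∀ n → ∃ λ i → l n i ≢ ℤ.+ 0)
    → (I : ℕ → Set)
    → (∀ m → ∃ λ n → m ≤ n × I n)
    → (lp : (n : ℕ) → I n → ℕ)
    → (∀ n (h : I n) → Prime (lp n h))
    → (∀ (ε : ℚ) → 0ℚ ℚ.< ε → ∃ λ N → ∀ n → N ≤ n → I n → ℚ.∣ evalForm (l n) ξ ∣ ℚ.< ε)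
    → (∀ n (h : I n) (i : Fin s) → v (lp n h) (l n Fin.zero) <∞ v (lp n h) (l n (Fin.suc i)))
    → (∀ M → ∃ λ N → ∀ n → N ≤ n → (h : I n) → M ≤ lp n h)
    → ⊥
lemma2p3 s ξ ξ₀≢0 l nontrivial _ unbounded lp lp-prime small gap large =
  let N₁ , close = small ε (ℚ.positive⁻¹ ε {{ℚ.normalize-pos 1 (suc (formDenominator-1 ξ))}})
      N₂ , p>H = large (suc H)
      n , N₁+N₂≤n , n∈I = unbounded (N₁ ℕ.+ N₂)
  in v-gap⇒↥evalFormᵘ≢0 (lp n n∈I) (l n) ξ (lp-prime n n∈I)
       (v-gap⇒leading≢0 s (lp n n∈I) (l n) (nontrivial n) (gap n n∈I)) (gap n n∈I)
       (ℕ.>⇒∤ (p>H n (ℕ.m+n≤o⇒n≤o N₁ N₁+N₂≤n) n∈I))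
       (evalForm-small⇒↥evalFormᵘ≡0 (l n) ξ (close n (ℕ.m+n≤o⇒m≤o N₁ N₁+N₂≤n) n∈I))
  where
  ε = + 1 ℚ./ suc (formDenominator-1 ξ)
  H = ∣ ↥ ξ Fin.zero ∣ ℕ.* suc (formDenominator-1 (ξ ∘ Fin.suc))
  instance
    _ = ℕ.≢-nonZero (ξ₀≢0 ∘ ℚ.↥p≡0⇒p≡0 (ξ Fin.zero) ∘ ℤ.∣i∣≡0⇒i≡0)
    _ = ℕ.m*n≢0 ∣ ↥ ξ Fin.zero ∣ (suc (formDenominator-1 (ξ ∘ Fin.suc)))
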